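{- Let $G$ be a graph whose vertex set is partitioned into $k$ cliques $V_1,\dots,V_k$, let $A=5$, $k'=Ak$, and let $G'$ be the graph constructed from $G$ as follows: for each vertex $u\in V(G)$ create an independent set $Z_u$ of $A$ new vertices; for each edge $uv\in E(G)$ add all edges between $Z_u$ and $Z_v$; for each $i\in\{1,\dots,k\}$ let $W_i=\bigcup_{u\in V_i}Z_u$ and add a new vertex $z_i$ adjacent to all vertices of $W_i$. If $G$ has an independent set of size at least $k$, then $G'$ has an upper dominating set of size at least $k'$.
   Context: A set $D$ of vertices is dominating if every vertex is in $D$ or adjacent to a vertex of $D$; an upper dominating set is an inclusion-minimal dominating set. The cliques $V_1,\dots,V_k$ may have arbitrary edges between them. -}

module Defs where

open import Level using (0ℓ)
open import Data.Nat using (ℕ; _*_; _≥_)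
open import Data.Fin using (Fin)
open import Data.Product using (_×_; Σ; ∃-syntax)
open import Data.Sum using (_⊎_; inj₁; inj₂)
open import Data.Empty using (⊥)
open import Data.List using (List; length)
open import Data.List.Membership.Propositional using (_∈_)
open import Data.List.Relation.Unary.Unique.Propositional using (Unique)
open import Relation.Nullary using (¬_)
open import Relation.Binary.PropositionalEquality using (_≡_)

record Graph : Set₁ where
  field
    n      : ℕ
    Adj    : Fin n → Fin n → Set
    sym    : ∀ {u v} → Adj u v → Adj v u
    irrefl : ∀ {u} → ¬ Adj u u

module _ {V : Set} (E : V → V → Set) where

  Dominating : (V → Set) → Set
  Dominating S = ∀ v → S v ⊎ ∃[ u ] (S u × E u v)

  -- A finite set D (duplicate-free list) is an upper dominating set:
  -- an inclusion-minimal dominating set.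
  UpperDominating : List V → Set₁
  UpperDominating D =
    Unique D ×
    Dominating (_∈ D) ×
    (∀ (S : V → Set) → (∀ x → S x → x ∈ D) → Dominating S → ∀ x → x ∈ D → S x)

  Independent : List V → Set
  Independent I = Unique I × (∀ x y → x ∈ I → y ∈ I → ¬ E x y)

-- Vertex set V(G) partitioned into k cliques V_1..V_k, given by part : V(G) → Fin k
-- (V_i = { u | part u ≡ i }); distinct vertices in the same part are adjacent.
IsCliquePartition : (G : Graph) (k : ℕ) → (Fin (Graph.n G) → Fin k) → Set
IsCliquePartition G k part =
  ∀ u v → part u ≡ part v → ¬ u ≡ v → Graph.Adj G u v

-- Vertices of G': Z_u = { (u , a) | a : Fin A } for u ∈ V(G), plus z_i for i : Fin k.
V' : (G : Graph) (k A : ℕ) → Set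
V' G k A = (Fin (Graph.n G) × Fin A) ⊎ Fin k

-- Edges of G': Z_u–Z_v complete iff uv ∈ E(G) (so each Z_u independent, as G is loopless);
-- z_i adjacent to all of W_i = ⋃_{u ∈ V_i} Z_u; no other edges.
Adj' : (G : Graph) (k A : ℕ) (part : Fin (Graph.n G) → Fin k) → V' G k A → V' G k A → Set
Adj' G k A part (inj₁ (u Data.Product., _)) (inj₁ (v Data.Product., _)) = Graph.Adj G u v
Adj' G k A part (inj₁ (u Data.Product., _)) (inj₂ i) = part u ≡ i
Adj' G k A part (inj₂ i) (inj₁ (u Data.Product., _)) = part u ≡ i
Adj' G k A part (inj₂ _) (inj₂ _) = ⊥

{-# OPTIONS --safe #-}
-- Take D = ⋃_{u ∈ I} Z_u.  Since G is covered by k cliques, an independent set of size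
-- at least k meets every clique V_i, so each z_i has a neighbour in D and each Z_w is
-- dominated by Z_u for the vertex u of I in the clique of w.  D is independent in G',
-- so a vertex of D has no neighbour in D and is dominated by no proper subset of D:
-- D is inclusion-minimal.
module Submission where

open import Defs
open import Data.Nat using (ℕ; suc; s≤s; _+_; _*_; _≥_; _≤_)
open import Data.Nat.Properties using (*-monoʳ-≤; *-comm; ≤-trans; ≤-reflexive)
open import Data.Fin using (Fin; zero; suc; punchOut; _≟_; _<_)
open import Data.Fin.Properties using (pigeonhole; punchOut-injective)
open import Data.Product using (_×_; ∃-syntax; _,_; proj₁)
open import Data.Sum using (inj₁; inj₂)
open import Data.List using (List; []; _∷_; _++_; map; length; lookup; allFin; cartesianProductWith)
open import Data.List.Properties using (length-++; length-map; length-tabulate)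
open import Data.List.Membership.Propositional using (_∈_; find; lose)
open import Data.List.Membership.Propositional.Properties
  using (∈-lookup; ∈-allFin; ∈-cartesianProductWith⁺; ∈-cartesianProductWith⁻)
open import Data.List.Relation.Unary.Any using (any?)
open import Data.List.Relation.Unary.All as All using ()
open import Data.List.Relation.Unary.AllPairs using (_∷_)
open import Data.List.Relation.Unary.Unique.Propositional using (Unique)
open import Data.List.Relation.Unary.Unique.Propositional.Properties
  using (cartesianProductWith⁺; allFin⁺)
open import Relation.Nullary using (¬_; yes; no; contradiction)
open import Relation.Binary.PropositionalEquality
  using (_≡_; _≢_; refl; sym; cong; cong₂; module ≡-Reasoning)

length-cartesianProductWith : {A B C : Set} (f : A → B → C) (xs : List A) (ys : List B) →
  length (cartesianProductWith f xs ys) ≡ length xs * length ys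
length-cartesianProductWith f []       ys = refl
length-cartesianProductWith f (x ∷ xs) ys = begin
  length (map (f x) ys ++ cartesianProductWith f xs ys)
    ≡⟨ length-++ (map (f x) ys) ⟩
  length (map (f x) ys) + length (cartesianProductWith f xs ys)
    ≡⟨ cong₂ _+_ (length-map (f x) ys) (length-cartesianProductWith f xs ys) ⟩
  length ys + length xs * length ys
    ∎
  where open ≡-Reasoning

Unique⇒lookup-distinct : {A : Set} (xs : List A) → Unique xs →
  (i j : Fin (length xs)) → i < j → lookup xs i ≢ lookup xs j
Unique⇒lookup-distinct (x ∷ xs) (x∉xs ∷ _) zero (suc j) _ = All.lookup x∉xs (∈-lookup j)
Unique⇒lookup-distinct (x ∷ xs) (_ ∷ u) (suc i) (suc j) (s≤s i<j) =
  Unique⇒lookup-distinct xs u i j i<j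

injectiveOn⇒onto : {A : Set} {k : ℕ} (f : A → Fin k) (xs : List A) → Unique xs →
  (∀ x y → x ∈ xs → y ∈ xs → f x ≡ f y → x ≡ y) → k ≤ length xs →
  ∀ i → ∃[ x ] (x ∈ xs × f x ≡ i)
injectiveOn⇒onto {k = suc _} f xs u inj k≤|xs| i with any? (λ x → f x ≟ i) xs
... | yes hit = find hit
... | no miss =
  let a , b , a<b , eq = pigeonhole k≤|xs| (λ a → punchOut (missed a)) in
  contradiction (inj _ _ (∈-lookup a) (∈-lookup b) (punchOut-injective (missed a) (missed b) eq))
                (Unique⇒lookup-distinct xs u a b a<b)
  where
  missed : ∀ a → i ≢ f (lookup xs a)
  missed a i≡f = miss (lose (∈-lookup a) (sym i≡f))

independent⇒minimal : {V : Set} (E : V → V → Set) (D : List V) →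
  (∀ x y → x ∈ D → y ∈ D → ¬ E x y) →
  ∀ (S : V → Set) → (∀ x → S x → x ∈ D) → Dominating E S → ∀ x → x ∈ D → S x
independent⇒minimal E D indep S S⊆D domS x x∈D with domS x
... | inj₁ Sx = Sx
... | inj₂ (y , Sy , Eyx) = contradiction Eyx (indep y x (S⊆D y Sy) x∈D)

module _ (G : Graph) (k : ℕ) (part : Fin (Graph.n G) → Fin k) where
  open Graph G using (n; Adj)

  independent-meets-every-part : IsCliquePartition G k part →
    (I : List (Fin n)) → Independent Adj I → k ≤ length I →
    ∀ i → ∃[ u ] (u ∈ I × part u ≡ i)
  independent-meets-every-part clique I (unique , indep) =
    injectiveOn⇒onto part I unique part-injectiveOn
    where
    part-injectiveOn : ∀ u v → u ∈ I → v ∈ I → part u ≡ part v → u ≡ v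
    part-injectiveOn u v u∈I v∈I same with u ≟ v
    ... | yes u≡v = u≡v
    ... | no  u≢v = contradiction (clique u v same u≢v) (indep u v u∈I v∈I)

  -- Blocks Z_u of size suc m: they must be nonempty for the z_i to be dominated.
  module _ (m : ℕ) where
    E′ : V' G k (suc m) → V' G k (suc m) → Set
    E′ = Adj' G k (suc m) part

    blowUp : List (Fin n) → List (V' G k (suc m))
    blowUp I = cartesianProductWith (λ u a → inj₁ (u , a)) I (allFin (suc m))

    ∈-blowUp⁺ : ∀ {I u} a → u ∈ I → inj₁ (u , a) ∈ blowUp I
    ∈-blowUp⁺ a u∈I = ∈-cartesianProductWith⁺ _ u∈I (∈-allFin a)

    ∈-blowUp⁻ : ∀ {I} x → x ∈ blowUp I → ∃[ u ] ∃[ a ] (u ∈ I × x ≡ inj₁ (u , a))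
    ∈-blowUp⁻ {I} x x∈ with ∈-cartesianProductWith⁻ _ I (allFin (suc m)) x∈
    ... | u , a , u∈I , _ , x≡ = u , a , u∈I , x≡

    blowUp-unique : ∀ {I} → Unique I → Unique (blowUp I)
    blowUp-unique u = cartesianProductWith⁺ _ (λ { refl → refl , refl }) u (allFin⁺ (suc m))

    length-blowUp : ∀ I → length (blowUp I) ≡ suc m * length I
    length-blowUp I = begin
      length (blowUp I)                  ≡⟨ length-cartesianProductWith _ I (allFin (suc m)) ⟩
      length I * length (allFin (suc m)) ≡⟨ cong (length I *_) (length-tabulate (λ a → a)) ⟩
      length I * suc m                   ≡⟨ *-comm (length I) (suc m) ⟩
      suc m * length I                   ∎
      where open ≡-Reasoning

    blowUp-independent : ∀ {I} → Independent Adj I →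
      ∀ x y → x ∈ blowUp I → y ∈ blowUp I → ¬ E′ x y
    blowUp-independent {I} (_ , indep) x y x∈ y∈ with ∈-blowUp⁻ {I} x x∈ | ∈-blowUp⁻ {I} y y∈
    ... | u , _ , u∈I , refl | v , _ , v∈I , refl = indep u v u∈I v∈I

    blowUp-dominating : IsCliquePartition G k part → ∀ {I} →
      (∀ i → ∃[ u ] (u ∈ I × part u ≡ i)) → Dominating E′ (_∈ blowUp I)
    blowUp-dominating clique meets (inj₁ (w , a)) with meets (part w)
    ... | u , u∈I , same with u ≟ w
    ...   | yes refl = inj₁ (∈-blowUp⁺ a u∈I)
    ...   | no  u≢w  = inj₂ (inj₁ (u , a) , ∈-blowUp⁺ a u∈I , clique u w same u≢w)
    blowUp-dominating clique meets (inj₂ i) with meets i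
    ... | u , u∈I , same = inj₂ (inj₁ (u , zero) , ∈-blowUp⁺ zero u∈I , same)

lemma1 : (G : Graph) (k : ℕ) (part : Fin (Graph.n G) → Fin k) →
    IsCliquePartition G k part →
    (∃[ I ] (Independent (Graph.Adj G) I × length I ≥ k)) →
    ∃[ D ] (UpperDominating (Adj' G k 5 part) D × length D ≥ 5 * k)
lemma1 G k part clique (I , indI , k≤|I|) =
  blowUp G k part 4 I ,
  ( blowUp-unique G k part 4 (proj₁ indI)
  , blowUp-dominating G k part 4 clique
      (independent-meets-every-part G k part clique I indI k≤|I|)
  , independent⇒minimal _ _ (blowUp-independent G k part 4 indI) ) ,
  ≤-trans (*-monoʳ-≤ 5 k≤|I|) (≤-reflexive (sym (length-blowUp G k part 4 I)))
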